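{- For an integer $d$, let $\mathcal{AP}_{(1,1,1,d)}(\mathbb{Q})$ be the set of triples $(x,y,z)\in\mathbb{Z}^3$ with $y-x=z-y$ satisfying $x^2+y^2+z^2=dxyz$. Then $\mathcal{AP}_{(1,1,1,1)}(\mathbb{Q})=\{(0,0,0),(3,3,3),(-15,-6,3),(3,-6,-15)\}$, $\mathcal{AP}_{(1,1,1,3)}(\mathbb{Q})=\{(0,0,0),(1,1,1),(-5,-2,1),(1,-2,-5)\}$, and if $d$ is a positive integer with $d\neq 1,3$, then $\mathcal{AP}_{(1,1,1,d)}(\mathbb{Q})=\{(0,0,0)\}$. -}

module Defs where

open import Data.Integer using (ℤ; _+_; _-_; _*_; +_; -_)
open import Data.Product using (_×_; _,_)
open import Relation.Binary.PropositionalEquality using (_≡_)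

InAP : ℤ → ℤ × ℤ × ℤ → Set
InAP d (x , y , z) =
  (y - x ≡ z - y) × (x * x + y * y + z * z ≡ d * x * y * z)

{-# OPTIONS --safe #-}
module Submission where

-- Write the progression as (m - r, m, m + r) and put k = d m. The equation becomes
-- r²(k + 2) = m²(k - 3); multiplying by k + 2 shows that (k - 3)(k + 2) m² is a square,
-- so for m ≠ 0 the integer (k - 3)(k + 2) is itself a square q². Since
-- (2k - 1)² = 4(k - 3)(k + 2) + 25 = (2q)² + 25, this forces |2k - 1| ≤ 13, hence
-- d, |m| ≤ 7 and then |r| ≤ 22; the remaining finitely many cases are decided by computation.

open import Data.Integer as ℤ using (ℤ; +_; -_; -[1+_]; _+_; _-_; _*_; _≟_; ∣_∣; _>_; +<+)
import Data.Integer.Properties as ℤₚ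
open import Data.Integer.Tactic.RingSolver using (solve-∀)
open import Data.List using (List; []; _∷_; _++_; map; upTo; applyUpTo)
open import Data.List.Membership.Propositional using (_∈_; _∉_)
open import Data.List.Membership.Propositional.Properties
  using (∈-map⁺; ∈-++⁺ˡ; ∈-++⁺ʳ; ∈-upTo⁺; ∈-applyUpTo⁺)
open import Data.List.Relation.Unary.All using (All; []; _∷_; all?; lookup)
open import Data.List.Relation.Unary.Any using (here; there; any?)
open import Data.Nat as ℕ using (ℕ; zero; suc; s≤s; NonZero)
import Data.Nat.Properties as ℕₚ
open import Data.Nat.Coprimality using (Coprime; coprime-/gcd; coprime-divisor)
open import Data.Nat.Divisibility using (_∣_; divides; ∣-refl; ∣-trans; m∣m*n; 0∣⇒≡0; *-cancelʳ-∣)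
open import Data.Nat.DivMod using (_/_; m/n*n≡m)
open import Data.Nat.GCD using (gcd; gcd[m,n]∣m; gcd[m,n]∣n; gcd[m,n]≢0)
import Data.Nat.Tactic.RingSolver as ℕ-Solver
open import Data.Product as Product using (_×_; _,_; ∃-syntax)
open import Data.Product.Properties using (≡-dec)
open import Data.Sum using (_⊎_; inj₁; inj₂; [_,_]; reduce)
open import Data.Sum.Function.Propositional using (_⊎-⇔_)
open import Function using (id; _∘_)
open import Function.Bundles using (_⇔_; mk⇔)
open import Function.Construct.Composition using (_⇔-∘_)
open import Function.Construct.Identity using (⇔-id)
open import Relation.Binary.Definitions using (DecidableEquality)
open import Relation.Binary.PropositionalEquality
  using (_≡_; _≢_; refl; sym; trans; cong; cong₂; subst; subst₂; module ≡-Reasoning)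
open import Relation.Nullary using (Dec; contradiction)
open import Relation.Nullary.Decidable using (yes; no; _⊎-dec_; _→-dec_; from-yes)
open import Defs

m*m<n*n⇒m<n : ∀ {m n} → m ℕ.* m ℕ.< n ℕ.* n → m ℕ.< n
m*m<n*n⇒m<n m*m<n*n = ℕₚ.≰⇒> (λ n≤m → ℕₚ.<⇒≱ m*m<n*n (ℕₚ.*-mono-≤ n≤m n≤m))

m*m≤n*n⇒m≤n : ∀ {m n} → m ℕ.* m ℕ.≤ n ℕ.* n → m ℕ.≤ n
m*m≤n*n⇒m≤n m*m≤n*n = ℕₚ.≮⇒≥ (λ n<m → ℕₚ.<⇒≱ (ℕₚ.*-mono-< n<m n<m) m*m≤n*n)

m*m≡n*n+1+c⇒2n≤c : ∀ m n {c} → m ℕ.* m ≡ n ℕ.* n ℕ.+ suc c → 2 ℕ.* n ℕ.≤ c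
m*m≡n*n+1+c⇒2n≤c m n {c} eq = ℕ.s≤s⁻¹ (ℕₚ.+-cancelˡ-≤ (n ℕ.* n) _ _ (begin
  n ℕ.* n ℕ.+ suc (2 ℕ.* n) ≡⟨ square-suc n ⟨
  suc n ℕ.* suc n           ≤⟨ ℕₚ.*-mono-≤ n<m n<m ⟩
  m ℕ.* m                   ≡⟨ eq ⟩
  n ℕ.* n ℕ.+ suc c         ∎))
  where
  open ℕₚ.≤-Reasoning
  square-suc : ∀ n → suc n ℕ.* suc n ≡ n ℕ.* n ℕ.+ suc (2 ℕ.* n)
  square-suc = ℕ-Solver.solve-∀
  n<m : n ℕ.< m
  n<m = m*m<n*n⇒m<n (ℕₚ.≤-trans (ℕₚ.m<m+n (n ℕ.* n) ℕ.z<s) (ℕₚ.≤-reflexive (sym eq)))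

m*m≡n*n+25⇒m≤13 : ∀ m n → m ℕ.* m ≡ n ℕ.* n ℕ.+ 25 → m ℕ.≤ 13
m*m≡n*n+25⇒m≤13 m n eq = m*m≤n*n⇒m≤n (begin
  m ℕ.* m        ≡⟨ eq ⟩
  n ℕ.* n ℕ.+ 25 ≤⟨ ℕₚ.+-monoˡ-≤ 25 (ℕₚ.*-mono-≤ n≤12 n≤12) ⟩
  13 ℕ.* 13      ∎)
  where
  open ℕₚ.≤-Reasoning
  n≤12 : n ℕ.≤ 12
  n≤12 = ℕₚ.*-cancelˡ-≤ 2 (m*m≡n*n+1+c⇒2n≤c m n eq)

coprime∧m*m∣n*n⇒m≡1 : ∀ {m n} → Coprime m n → m ℕ.* m ∣ n ℕ.* n → m ≡ 1
coprime∧m*m∣n*n⇒m≡1 {m} coprime m*m∣n*n =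
  coprime (∣-refl , coprime-divisor coprime (∣-trans (m∣m*n m) m*m∣n*n))

-- Divide m and n by their gcd g: the quotients are coprime, so m / g = 1.
m*m∣n*n⇒m∣n : ∀ m n → m ℕ.* m ∣ n ℕ.* n → m ∣ n
m*m∣n*n⇒m∣n zero n 0∣n*n with ℕₚ.m*n≡0⇒m≡0∨n≡0 n (0∣⇒≡0 0∣n*n)
... | inj₁ refl = ∣-refl
... | inj₂ refl = ∣-refl
m*m∣n*n⇒m∣n m@(suc _) n m*m∣n*n = subst (_∣ n) g≡m (gcd[m,n]∣n m n)
  where
  g : ℕ
  g = gcd m n
  instance
    g≢0 : NonZero g
    g≢0 = ℕ.≢-nonZero (gcd[m,n]≢0 m n (inj₁ λ ()))
  m/g*g≡m : m / g ℕ.* g ≡ m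
  m/g*g≡m = m/n*n≡m (gcd[m,n]∣m m n)
  n/g*g≡n : n / g ℕ.* g ≡ n
  n/g*g≡n = m/n*n≡m (gcd[m,n]∣n m n)
  square-split : ∀ {a} → a / g ℕ.* g ≡ a → a ℕ.* a ≡ (a / g ℕ.* (a / g)) ℕ.* (g ℕ.* g)
  square-split {a} eq = trans (sym (cong₂ ℕ._*_ eq eq)) (ℕₚ.[m*n]*[o*p]≡[m*o]*[n*p] (a / g) g (a / g) g)
  m/g≡1 : m / g ≡ 1
  m/g≡1 = coprime∧m*m∣n*n⇒m≡1 (coprime-/gcd m n)
    (*-cancelʳ-∣ (g ℕ.* g) {{ℕₚ.m*n≢0 g g}}
      (subst₂ _∣_ (square-split m/g*g≡m) (square-split n/g*g≡n) m*m∣n*n))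
  g≡m : g ≡ m
  g≡m = trans (sym (ℕₚ.*-identityˡ g)) (trans (cong (ℕ._* g) (sym m/g≡1)) m/g*g≡m)

square-multiple⇒square : ∀ n m u .{{_ : NonZero m}} →
                         n ℕ.* (m ℕ.* m) ≡ u ℕ.* u → ∃[ q ] n ≡ q ℕ.* q
square-multiple⇒square n m u eq =
  q , ℕₚ.*-cancelʳ-≡ n (q ℕ.* q) (m ℕ.* m) {{ℕₚ.m*n≢0 m m}} (begin
    n ℕ.* (m ℕ.* m)         ≡⟨ eq ⟩
    u ℕ.* u                 ≡⟨ cong₂ ℕ._*_ u≡q*m u≡q*m ⟩
    (q ℕ.* m) ℕ.* (q ℕ.* m) ≡⟨ ℕₚ.[m*n]*[o*p]≡[m*o]*[n*p] q m q m ⟩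
    (q ℕ.* q) ℕ.* (m ℕ.* m) ∎)
  where
  open ≡-Reasoning
  open _∣_ (m*m∣n*n⇒m∣n m u (divides n (sym eq))) renaming (quotient to q; equality to u≡q*m)

i*i≡+∣i∣*∣i∣ : ∀ i → i * i ≡ + (∣ i ∣ ℕ.* ∣ i ∣)
i*i≡+∣i∣*∣i∣ (+ n)    = ℤₚ.+◃n≡+n _
i*i≡+∣i∣*∣i∣ -[1+ n ] = ℤₚ.+◃n≡+n _

-- For negative n, splitting m makes n * (m * m) compute to a negative literal, while u * u is not negative.
square-multiple⇒squareℤ : ∀ n {m} u → m ≢ + 0 → n * (m * m) ≡ u * u → ∃[ q ] n ≡ q * q
square-multiple⇒squareℤ (+ n) {m} u m≢0 eq =
  Product.map +_ (λ {q} n≡q*q → trans (cong +_ n≡q*q) (ℤₚ.pos-* q q))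
    (square-multiple⇒square n ∣ m ∣ ∣ u ∣ {{∣m∣≢0}} (begin
      n ℕ.* (∣ m ∣ ℕ.* ∣ m ∣) ≡⟨ cong (n ℕ.*_) (ℤₚ.abs-* m m) ⟨
      n ℕ.* ∣ m * m ∣         ≡⟨ ℤₚ.abs-* (+ n) (m * m) ⟨
      ∣ + n * (m * m) ∣       ≡⟨ cong ∣_∣ eq ⟩
      ∣ u * u ∣               ≡⟨ ℤₚ.abs-* u u ⟩
      ∣ u ∣ ℕ.* ∣ u ∣         ∎))
  where
  open ≡-Reasoning
  ∣m∣≢0 : NonZero ∣ m ∣
  ∣m∣≢0 = ℕ.≢-nonZero (m≢0 ∘ ℤₚ.∣i∣≡0⇒i≡0)
square-multiple⇒squareℤ -[1+ _ ] {+ zero} _ m≢0 _ = contradiction refl m≢0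
square-multiple⇒squareℤ -[1+ _ ] {+ suc _} u _ eq = contradiction (trans eq (i*i≡+∣i∣*∣i∣ u)) λ ()
square-multiple⇒squareℤ -[1+ _ ] { -[1+ _ ]} u _ eq = contradiction (trans eq (i*i≡+∣i∣*∣i∣ u)) λ ()

i*i≡j*j+25⇒∣i∣≤13 : ∀ i j → i * i ≡ j * j + + 25 → ∣ i ∣ ℕ.≤ 13
i*i≡j*j+25⇒∣i∣≤13 i j eq = m*m≡n*n+25⇒m≤13 ∣ i ∣ ∣ j ∣ (ℤₚ.+-injective
  (trans (sym (i*i≡+∣i∣*∣i∣ i)) (trans eq (cong (_+ + 25) (i*i≡+∣i∣*∣i∣ j)))))

∣2i-1∣≤13⇒∣i∣≤7 : ∀ i → ∣ + 2 * i - + 1 ∣ ℕ.≤ 13 → ∣ i ∣ ℕ.≤ 7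
∣2i-1∣≤13⇒∣i∣≤7 i ∣2i-1∣≤13 = ℕₚ.*-cancelˡ-≤ 2 (begin
  2 ℕ.* ∣ i ∣                  ≡⟨ ℤₚ.abs-* (+ 2) i ⟨
  ∣ + 2 * i ∣                  ≡⟨ cong ∣_∣ (2i≡2i-1+1 i) ⟩
  ∣ + 2 * i - + 1 + + 1 ∣      ≤⟨ ℤₚ.∣i+j∣≤∣i∣+∣j∣ (+ 2 * i - + 1) (+ 1) ⟩
  ∣ + 2 * i - + 1 ∣ ℕ.+ 1      ≤⟨ ℕₚ.+-monoˡ-≤ 1 ∣2i-1∣≤13 ⟩
  2 ℕ.* 7                      ∎)
  where
  open ℕₚ.≤-Reasoning
  2i≡2i-1+1 : ∀ i → + 2 * i ≡ + 2 * i - + 1 + + 1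
  2i≡2i-1+1 = solve-∀

∣i∣≤∣i*j∣ : ∀ i {j} → j ≢ + 0 → ∣ i ∣ ℕ.≤ ∣ i * j ∣
∣i∣≤∣i*j∣ i {j} j≢0 = ℕₚ.≤-trans (ℕₚ.m≤m*n ∣ i ∣ ∣ j ∣ {{ℕ.≢-nonZero (j≢0 ∘ ℤₚ.∣i∣≡0⇒i≡0)}})
                                  (ℕₚ.≤-reflexive (sym (ℤₚ.abs-* i j)))

progression : ℤ → ℤ → ℤ × ℤ × ℤ
progression m r = m - r , m , m + r

ReducedEquation : ℤ → ℤ → ℤ → Set
ReducedEquation k m r = r * r * (k + + 2) ≡ m * m * (k - + 3)

InAP⇒≡progression : ∀ d x y z → InAP d (x , y , z) → (x , y , z) ≡ progression y (z - y)
InAP⇒≡progression _ x y z (y-x≡z-y , _) =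
  cong₂ _,_ (trans (x≡y-[y-x] x y) (cong (λ s → y - s) y-x≡z-y)) (cong (y ,_) (z≡y+[z-y] y z))
  where
  x≡y-[y-x] : ∀ x y → x ≡ y - (y - x)
  x≡y-[y-x] = solve-∀
  z≡y+[z-y] : ∀ y z → z ≡ y + (z - y)
  z≡y+[z-y] = solve-∀

InAP-progression⇒reduced : ∀ d m r → InAP d (progression m r) → ReducedEquation (d * m) m r
InAP-progression⇒reduced d m r (_ , eq) = ℤₚ.i-j≡0⇒i≡j _ _ (begin
  r * r * (d * m + + 2) - m * m * (d * m - + 3) ≡⟨ reduced-difference d m r ⟩
  sum-of-squares - product                      ≡⟨ cong (_- product) eq ⟩
  product - product                             ≡⟨ ℤₚ.+-inverseʳ product ⟩
  + 0                                           ∎)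
  where
  open ≡-Reasoning
  sum-of-squares product : ℤ
  sum-of-squares = (m - r) * (m - r) + m * m + (m + r) * (m + r)
  product = d * (m - r) * m * (m + r)
  reduced-difference : ∀ d m r →
    r * r * (d * m + + 2) - m * m * (d * m - + 3)
      ≡ (m - r) * (m - r) + m * m + (m + r) * (m + r) - d * (m - r) * m * (m + r)
  reduced-difference = solve-∀

reduced⇒r≡0 : ∀ d r → ReducedEquation (d * + 0) (+ 0) r → r ≡ + 0
reduced⇒r≡0 d r eq with ℤₚ.i*j≡0⇒i≡0∨j≡0 (r * r)
                            (trans (cong (λ k → r * r * (k + + 2)) (sym (ℤₚ.*-zeroʳ d))) eq)
... | inj₁ r*r≡0 = reduce (ℤₚ.i*j≡0⇒i≡0∨j≡0 r r*r≡0)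

reduced⇒k+2≢0 : ∀ k m r → m ≢ + 0 → ReducedEquation k m r → k + + 2 ≢ + 0
reduced⇒k+2≢0 k m r m≢0 eq k+2≡0
  with ℤₚ.i*j≡0⇒i≡0∨j≡0 (m * m) (trans (sym eq) (trans (cong (r * r *_) k+2≡0) (ℤₚ.*-zeroʳ (r * r))))
... | inj₁ m*m≡0 = m≢0 (reduce (ℤₚ.i*j≡0⇒i≡0∨j≡0 m m*m≡0))
... | inj₂ k-3≡0 with () ← trans (cong (_+ + 2) (sym (ℤₚ.i-j≡0⇒i≡j k (+ 3) k-3≡0))) k+2≡0

reduced⇒∣k∣≤7 : ∀ k m r → m ≢ + 0 → ReducedEquation k m r → ∣ k ∣ ℕ.≤ 7
reduced⇒∣k∣≤7 k m r m≢0 eq = ∣2i-1∣≤13⇒∣i∣≤7 k (i*i≡j*j+25⇒∣i∣≤13 (+ 2 * k - + 1) (+ 2 * q) (begin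
  (+ 2 * k - + 1) * (+ 2 * k - + 1) ≡⟨ completed-square k ⟩
  + 4 * N + + 25                    ≡⟨ cong (λ n → + 4 * n + + 25) N≡q*q ⟩
  + 4 * (q * q) + + 25              ≡⟨ four-squares q ⟩
  (+ 2 * q) * (+ 2 * q) + + 25      ∎))
  where
  open ≡-Reasoning
  N : ℤ
  N = (k - + 3) * (k + + 2)
  N*m²≡u² : N * (m * m) ≡ (r * (k + + 2)) * (r * (k + + 2))
  N*m²≡u² = begin
    N * (m * m)                       ≡⟨ rearrange k m ⟩
    m * m * (k - + 3) * (k + + 2)     ≡⟨ cong (_* (k + + 2)) eq ⟨
    r * r * (k + + 2) * (k + + 2)     ≡⟨ regroup k r ⟩
    (r * (k + + 2)) * (r * (k + + 2)) ∎
    where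
    rearrange : ∀ k m → (k - + 3) * (k + + 2) * (m * m) ≡ m * m * (k - + 3) * (k + + 2)
    rearrange = solve-∀
    regroup : ∀ k r → r * r * (k + + 2) * (k + + 2) ≡ (r * (k + + 2)) * (r * (k + + 2))
    regroup = solve-∀
  open Product.Σ (square-multiple⇒squareℤ N (r * (k + + 2)) m≢0 N*m²≡u²)
    renaming (proj₁ to q; proj₂ to N≡q*q)
  completed-square : ∀ k → (+ 2 * k - + 1) * (+ 2 * k - + 1) ≡ + 4 * ((k - + 3) * (k + + 2)) + + 25
  completed-square = solve-∀
  four-squares : ∀ q → + 4 * (q * q) + + 25 ≡ (+ 2 * q) * (+ 2 * q) + + 25
  four-squares = solve-∀

reduced⇒∣r∣≤22 : ∀ k m r → m ≢ + 0 → ∣ k ∣ ℕ.≤ 7 → ∣ m ∣ ℕ.≤ 7 →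
                 ReducedEquation k m r → ∣ r ∣ ℕ.≤ 22
reduced⇒∣r∣≤22 k m r m≢0 ∣k∣≤7 ∣m∣≤7 eq = ℕ.s≤s⁻¹ (m*m<n*n⇒m<n (begin-strict
  ∣ r ∣ ℕ.* ∣ r ∣                           ≡⟨ ℤₚ.abs-* r r ⟨
  ∣ r * r ∣                                 ≤⟨ ∣i∣≤∣i*j∣ (r * r) (reduced⇒k+2≢0 k m r m≢0 eq) ⟩
  ∣ r * r * (k + + 2) ∣                     ≡⟨ cong ∣_∣ eq ⟩
  ∣ m * m * (k - + 3) ∣                     ≡⟨ ℤₚ.abs-* (m * m) (k - + 3) ⟩
  ∣ m * m ∣ ℕ.* ∣ k - + 3 ∣                 ≡⟨ cong (ℕ._* ∣ k - + 3 ∣) (ℤₚ.abs-* m m) ⟩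
  ∣ m ∣ ℕ.* ∣ m ∣ ℕ.* ∣ k - + 3 ∣           ≤⟨ ℕₚ.*-mono-≤ (ℕₚ.*-mono-≤ ∣m∣≤7 ∣m∣≤7) ∣k-3∣≤10 ⟩
  7 ℕ.* 7 ℕ.* 10                            <⟨ ℕₚ.m<m+n 490 ℕ.z<s ⟩
  23 ℕ.* 23                                 ∎))
  where
  open ℕₚ.≤-Reasoning
  ∣k-3∣≤10 : ∣ k - + 3 ∣ ℕ.≤ 10
  ∣k-3∣≤10 = ℕₚ.≤-trans (ℤₚ.∣i-j∣≤∣i∣+∣j∣ k (+ 3)) (ℕₚ.+-monoˡ-≤ 3 ∣k∣≤7)

positiveUpTo : ℕ → List ℤ
positiveUpTo n = applyUpTo (λ i → + suc i) n

absUpTo : ℕ → List ℤ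
absUpTo n = map +_ (upTo (suc n)) ++ map -[1+_] (upTo n)

∈-positiveUpTo : ∀ {n i} → suc i ℕ.≤ n → + suc i ∈ positiveUpTo n
∈-positiveUpTo = ∈-applyUpTo⁺ (λ i → + suc i)

∈-absUpTo : ∀ {n} i → ∣ i ∣ ℕ.≤ n → i ∈ absUpTo n
∈-absUpTo (+ a)    a≤n = ∈-++⁺ˡ (∈-map⁺ +_ (∈-upTo⁺ (s≤s a≤n)))
∈-absUpTo -[1+ a ] a<n = ∈-++⁺ʳ _ (∈-map⁺ -[1+_] (∈-upTo⁺ a<n))

sporadic : ℤ → List (ℤ × ℤ × ℤ)
sporadic (+ 1) = (+ 3 , + 3 , + 3) ∷ (- (+ 15) , - (+ 6) , + 3) ∷ (+ 3 , - (+ 6) , - (+ 15)) ∷ []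
sporadic (+ 3) = (+ 1 , + 1 , + 1) ∷ (- (+ 5) , - (+ 2) , + 1) ∷ (+ 1 , - (+ 2) , - (+ 5)) ∷ []
sporadic _     = []

sporadic-InAP : ∀ d → All (InAP d) (sporadic d)
sporadic-InAP (+ 0)                        = []
sporadic-InAP (+ 1)                        = (refl , refl) ∷ (refl , refl) ∷ (refl , refl) ∷ []
sporadic-InAP (+ 2)                        = []
sporadic-InAP (+ 3)                        = (refl , refl) ∷ (refl , refl) ∷ (refl , refl) ∷ []
sporadic-InAP (+ suc (suc (suc (suc _)))) = []
sporadic-InAP -[1+ _ ]                     = []

∉-sporadic : ∀ {d t} → d ≢ + 1 → d ≢ + 3 → t ∉ sporadic d
∉-sporadic {+ 1} d≢1 _ = contradiction refl d≢1
∉-sporadic {+ 3} _ d≢3 = contradiction refl d≢3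
∉-sporadic {+ 0} _ _ ()
∉-sporadic {+ 2} _ _ ()
∉-sporadic {+ suc (suc (suc (suc _)))} _ _ ()
∉-sporadic { -[1+ _ ]} _ _ ()

Classified : ℤ → ℤ × ℤ × ℤ → Set
Classified d t = t ≡ (+ 0 , + 0 , + 0) ⊎ t ∈ sporadic d

_≟³_ : DecidableEquality (ℤ × ℤ × ℤ)
_≟³_ = ≡-dec _≟_ (≡-dec _≟_ _≟_)

classified? : ∀ d t → Dec (Classified d t)
classified? d t = (t ≟³ _) ⊎-dec any? (t ≟³_) (sporadic d)

bounded-progressions-classified :
  All (λ d → All (λ m → All (λ r → ReducedEquation (d * m) m r → Classified d (progression m r))
                            (absUpTo 22))
                 (absUpTo 7))
      (positiveUpTo 7)
bounded-progressions-classified =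
  from-yes (all? (λ d → all? (λ m → all? (λ r →
    (r * r * (d * m + + 2) ≟ m * m * (d * m - + 3)) →-dec classified? d (progression m r))
    (absUpTo 22)) (absUpTo 7)) (positiveUpTo 7))

progression-classified : ∀ n m r → ReducedEquation (+ suc n * m) m r →
                         Classified (+ suc n) (progression m r)
progression-classified n m r eq with m ≟ + 0
... | yes refl rewrite reduced⇒r≡0 (+ suc n) r eq = inj₁ refl
... | no m≢0 = lookup (lookup (lookup bounded-progressions-classified d∈) m∈) r∈ eq
  where
  ∣k∣≤7 : ∣ + suc n * m ∣ ℕ.≤ 7
  ∣k∣≤7 = reduced⇒∣k∣≤7 (+ suc n * m) m r m≢0 eq
  ∣k∣≡d*∣m∣ : ∣ + suc n * m ∣ ≡ suc n ℕ.* ∣ m ∣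
  ∣k∣≡d*∣m∣ = ℤₚ.abs-* (+ suc n) m
  instance
    ∣m∣≢0 : NonZero ∣ m ∣
    ∣m∣≢0 = ℕ.≢-nonZero (m≢0 ∘ ℤₚ.∣i∣≡0⇒i≡0)
  ∣m∣≤7 : ∣ m ∣ ℕ.≤ 7
  ∣m∣≤7 = ℕₚ.≤-trans (ℕₚ.m≤n*m ∣ m ∣ (suc n)) (subst (ℕ._≤ 7) ∣k∣≡d*∣m∣ ∣k∣≤7)
  d∈ : + suc n ∈ positiveUpTo 7
  d∈ = ∈-positiveUpTo (ℕₚ.≤-trans (ℕₚ.m≤m*n (suc n) ∣ m ∣) (subst (ℕ._≤ 7) ∣k∣≡d*∣m∣ ∣k∣≤7))
  m∈ : m ∈ absUpTo 7
  m∈ = ∈-absUpTo m ∣m∣≤7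
  r∈ : r ∈ absUpTo 22
  r∈ = ∈-absUpTo r (reduced⇒∣r∣≤22 (+ suc n * m) m r m≢0 ∣k∣≤7 ∣m∣≤7 eq)

classification : ∀ {d} t → d > + 0 → InAP d t → Classified d t
classification {+ suc n} (x , y , z) _ ap =
  subst (Classified (+ suc n)) (sym t≡progression)
    (progression-classified n y (z - y) (InAP-progression⇒reduced (+ suc n) y (z - y) ap′))
  where
  t≡progression : (x , y , z) ≡ progression y (z - y)
  t≡progression = InAP⇒≡progression (+ suc n) x y z ap
  ap′ : InAP (+ suc n) (progression y (z - y))
  ap′ = subst (InAP (+ suc n)) t≡progression ap
classification {+ zero} _ (+<+ ()) _

classified⇒InAP : ∀ d {t} → Classified d t → InAP d t
classified⇒InAP d (inj₁ refl) = refl , sym (cong (λ i → i * + 0 * + 0) (ℤₚ.*-zeroʳ d))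
classified⇒InAP d (inj₂ t∈)   = lookup (sporadic-InAP d) t∈

InAP⇔Classified : ∀ d → d > + 0 → (t : ℤ × ℤ × ℤ) → InAP d t ⇔ Classified d t
InAP⇔Classified d d>0 t = mk⇔ (classification t d>0) (classified⇒InAP d)

∈[a,b,c]⇔ : ∀ {A : Set} {x a b c : A} → x ∈ a ∷ b ∷ c ∷ [] ⇔ (x ≡ a ⊎ x ≡ b ⊎ x ≡ c)
∈[a,b,c]⇔ {x = x} {a} {b} {c} = mk⇔ to from
  where
  to : x ∈ a ∷ b ∷ c ∷ [] → x ≡ a ⊎ x ≡ b ⊎ x ≡ c
  to (here x≡a)                = inj₁ x≡a
  to (there (here x≡b))        = inj₂ (inj₁ x≡b)
  to (there (there (here x≡c))) = inj₂ (inj₂ x≡c)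
  from : x ≡ a ⊎ x ≡ b ⊎ x ≡ c → x ∈ a ∷ b ∷ c ∷ []
  from (inj₁ x≡a)        = here x≡a
  from (inj₂ (inj₁ x≡b)) = there (here x≡b)
  from (inj₂ (inj₂ x≡c)) = there (there (here x≡c))

theorem3 :
    ((t : ℤ × ℤ × ℤ) → InAP (+ 1) t ⇔
        (t ≡ (+ 0 , + 0 , + 0) ⊎ t ≡ (+ 3 , + 3 , + 3)
          ⊎ t ≡ (- (+ 15) , - (+ 6) , + 3) ⊎ t ≡ (+ 3 , - (+ 6) , - (+ 15))))
    × ((t : ℤ × ℤ × ℤ) → InAP (+ 3) t ⇔
        (t ≡ (+ 0 , + 0 , + 0) ⊎ t ≡ (+ 1 , + 1 , + 1)
          ⊎ t ≡ (- (+ 5) , - (+ 2) , + 1) ⊎ t ≡ (+ 1 , - (+ 2) , - (+ 5))))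
    × ((d : ℤ) → d > + 0 → d ≢ + 1 → d ≢ + 3 → (t : ℤ × ℤ × ℤ) →
        InAP d t ⇔ (t ≡ (+ 0 , + 0 , + 0)))
theorem3 = (λ t → (⇔-id _ ⊎-⇔ ∈[a,b,c]⇔) ⇔-∘ InAP⇔Classified (+ 1) (+<+ ℕ.z<s) t)
         , (λ t → (⇔-id _ ⊎-⇔ ∈[a,b,c]⇔) ⇔-∘ InAP⇔Classified (+ 3) (+<+ ℕ.z<s) t)
         , λ d d>0 d≢1 d≢3 t →
             (mk⇔ [ id , (λ t∈ → contradiction t∈ (∉-sporadic d≢1 d≢3)) ] inj₁) ⇔-∘ InAP⇔Classified d d>0 t
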